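{- Let $\{A,B\}$ be a bipartition of $[n]$ with $\min\{|A|,|B|\}\ge2$ and let $\mathcal{Q}$ be a compatible complete bipartite quartet system relative to $\{A,B\}$. Then a laminarizable $\{A,B\}$-cut family displaying $\mathcal{Q}$ is uniquely determined up to $\sim$.
   Context: Quartets $ab\|cd$, $ab|cd$; a tree displays $ab\|cd$ if the paths $a$–$b$ and $c$–$d$ are disjoint, and $ab|cd$ if they share at most one node; a quartet system is compatible if some phylogenetic tree (tree with leaf set $[n]$, internal nodes of degree $\ge3$) displays all its quartets. $\mathcal{Q}$ is complete bipartite relative to $\{A,B\}$ if for all distinct $a,a'\in A$ and distinct $b,b'\in B$ exactly one of $ab\|a'b'$, $ab'\|a'b$, $aa'|bb'$ belongs to $\mathcal{Q}$ and all quartets in $\mathcal{Q}$ have these forms. A family $\mathcal{F}\subseteq 2^{[n]}$ displays $\mathcal{Q}$ if for all distinct $a,a'\in A$ and distinct $b,b'\in B$: $ab\|a'b'\in\mathcal{Q}$ iff some $X\in\mathcal{F}$ has $a,b\in X\not\ni a',b'$ or $a,b\notin X\ni a',b'$. An $\{A,B\}$-cut is a set $X\subseteq[n]$ with $\emptyset\ne X\cap A\ne A$ and $\emptyset\ne X\cap B\ne B$. For $\{A,B\}$-cuts, $X\sim Y$ iff $X=Y$ or $X=[n]\setminus Y$; for families of $\{A,B\}$-cuts, $\mathcal{F}\sim\mathcal{G}$ iff they have the same set of $\sim$-classes. A family of $\{A,B\}$-cuts $\mathcal{F}$ is laminarizable if there is a laminar family $\mathcal{L}$ of $\{A,B\}$-cuts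 with $\mathcal{F}\sim\mathcal{L}$ (laminar: any two members are nested or disjoint). -}

module Defs where

open import Data.Nat using (ℕ; _≤_)
open import Data.Fin using (Fin)
open import Data.Fin.Subset using (Subset; _∈_; _∉_; _⊆_; ∁; _∩_; ⊥; ∣_∣; Nonempty)
open import Data.List using (List; []; _∷_)
import Data.List.Membership.Propositional as LM
open import Data.List.Relation.Unary.Unique.Propositional using (Unique)
open import Data.Product using (Σ; ∃; _×_; _,_)
open import Data.Sum using (_⊎_)
open import Relation.Nullary using (¬_)
open import Relation.Binary.PropositionalEquality using (_≡_; _≢_)
open import Function.Bundles using (_⇔_)
open import Level using (0ℓ)

data Walk {m : ℕ} (adj : Fin m → Subset m) : Fin m → Fin m → List (Fin m) → Set where
  here : ∀ {u} → Walk adj u u (u ∷ [])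
  step : ∀ {u w v p} → w ∈ adj u → Walk adj w v p → Walk adj u v (u ∷ p)

SimplePath : {m : ℕ} → (Fin m → Subset m) → Fin m → Fin m → List (Fin m) → Set
SimplePath adj u v p = Walk adj u v p × Unique p

record PhyloTree (n : ℕ) : Set where
  field
    m      : ℕ
    adj    : Fin m → Subset m
    irrefl : ∀ u → u ∉ adj u
    sym    : ∀ u v → v ∈ adj u → u ∈ adj v
    connected : ∀ u v → ∃ λ p → SimplePath adj u v p
    uniquePath : ∀ u v p q → SimplePath adj u v p → SimplePath adj u v q → p ≡ q
    leaf   : Fin n → Fin m
    leaf-injective : ∀ i j → leaf i ≡ leaf j → i ≡ j
    leaf-degree : ∀ i → ∣ adj (leaf i) ∣ ≡ 1
    internal-degree : ∀ v → (∀ i → leaf i ≢ v) → 3 ≤ ∣ adj v ∣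

data Quartet (n : ℕ) : Set where
  strong : Fin n → Fin n → Fin n → Fin n → Quartet n   -- ab‖cd
  weak   : Fin n → Fin n → Fin n → Fin n → Quartet n   -- ab|cd

module _ {n : ℕ} (T : PhyloTree n) where
  open PhyloTree T

  DisplaysStrong : Fin n → Fin n → Fin n → Fin n → Set
  DisplaysStrong a b c d = ∀ p q → SimplePath adj (leaf a) (leaf b) p →
    SimplePath adj (leaf c) (leaf d) q → ∀ x → x LM.∈ p → ¬ (x LM.∈ q)

  DisplaysWeak : Fin n → Fin n → Fin n → Fin n → Set
  DisplaysWeak a b c d = ∀ p q → SimplePath adj (leaf a) (leaf b) p →
    SimplePath adj (leaf c) (leaf d) q →
    ∀ x y → x LM.∈ p → x LM.∈ q → y LM.∈ p → y LM.∈ q → x ≡ y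

  Displays : Quartet n → Set
  Displays (strong a b c d) = DisplaysStrong a b c d
  Displays (weak a b c d)   = DisplaysWeak a b c d

-- A quartet system is a set of quartets, given as a predicate on
-- representatives; quartets are unordered, i.e. ab?cd = ba?cd = ab?dc = cd?ab.
QuartetSystem : ℕ → Set₁
QuartetSystem n = Quartet n → Set

PairEq : {n : ℕ} → Fin n → Fin n → Fin n → Fin n → Set
PairEq a b x y = (a ≡ x × b ≡ y) ⊎ (a ≡ y × b ≡ x)

SameSplit : {n : ℕ} → (a b c d x y z w : Fin n) → Set
SameSplit a b c d x y z w =
  (PairEq a b x y × PairEq c d z w) ⊎ (PairEq a b z w × PairEq c d x y)

_≈q_ : {n : ℕ} → Quartet n → Quartet n → Set
strong a b c d ≈q strong x y z w = SameSplit a b c d x y z w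
weak a b c d   ≈q weak x y z w   = SameSplit a b c d x y z w
_ ≈q _ = Data.Empty.⊥
  where import Data.Empty

_∈Q_ : {n : ℕ} → Quartet n → QuartetSystem n → Set
q ∈Q Q = ∃ λ q' → Q q' × q' ≈q q

Compatible : {n : ℕ} → QuartetSystem n → Set
Compatible {n} Q = Σ (PhyloTree n) λ T → ∀ q → Q q → Displays T q

ExactlyOne : Set → Set → Set → Set
ExactlyOne P Q R = (P × ¬ Q × ¬ R) ⊎ (¬ P × Q × ¬ R) ⊎ (¬ P × ¬ Q × R)

-- Bipartition {A,B} of [n] given by A, with B = ∁ A.
CompleteBipartite : {n : ℕ} → (A : Subset n) → QuartetSystem n → Set
CompleteBipartite {n} A Q =
  (∀ (a a' b b' : Fin n) → a ∈ A → a' ∈ A → a ≢ a' → b ∈ ∁ A → b' ∈ ∁ A → b ≢ b' →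
     ExactlyOne (strong a b a' b' ∈Q Q) (strong a b' a' b ∈Q Q) (weak a a' b b' ∈Q Q))
  × (∀ q → Q q → ∃ λ a → ∃ λ a' → ∃ λ b → ∃ λ b' →
       a ∈ A × a' ∈ A × a ≢ a' × b ∈ ∁ A × b' ∈ ∁ A × b ≢ b' ×
       (q ≈q strong a b a' b' ⊎ q ≈q weak a a' b b'))

Family : ℕ → Set₁
Family n = Subset n → Set

FamilyDisplays : {n : ℕ} → (A : Subset n) → Family n → QuartetSystem n → Set
FamilyDisplays {n} A F Q =
  ∀ (a a' b b' : Fin n) → a ∈ A → a' ∈ A → a ≢ a' → b ∈ ∁ A → b' ∈ ∁ A → b ≢ b' →
    (strong a b a' b' ∈Q Q) ⇔
    (∃ λ X → F X × ((a ∈ X × b ∈ X × a' ∉ X × b' ∉ X) ⊎ (a ∉ X × b ∉ X × a' ∈ X × b' ∈ X)))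

IsCut : {n : ℕ} → (A : Subset n) → Subset n → Set
IsCut A X = Nonempty (X ∩ A) × ¬ (X ∩ A ≡ A) × Nonempty (X ∩ ∁ A) × ¬ (X ∩ ∁ A ≡ ∁ A)

CutFamily : {n : ℕ} → (A : Subset n) → Family n → Set
CutFamily A F = ∀ X → F X → IsCut A X

_∼_ : {n : ℕ} → Subset n → Subset n → Set
X ∼ Y = X ≡ Y ⊎ X ≡ ∁ Y

-- same set of ∼-classes
_∼F_ : {n : ℕ} → Family n → Family n → Set
F ∼F G = (∀ X → F X → ∃ λ Y → G Y × X ∼ Y) × (∀ Y → G Y → ∃ λ X → F X × X ∼ Y)

Laminar : {n : ℕ} → Family n → Set
Laminar L = ∀ X Y → L X → L Y → X ⊆ Y ⊎ Y ⊆ X ⊎ X ∩ Y ≡ ⊥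

Laminarizable : {n : ℕ} → (A : Subset n) → Family n → Set₁
Laminarizable {n} A F = Σ (Family n) λ L → CutFamily A L × Laminar L × F ∼F L

module Submission where

-- Let F and G be {A,B}-cut families displaying the same quartet system Q,
-- with G laminarizable.  We show every X ∈ F is ∼-equivalent to some Y ∈ G;
-- by symmetry this gives F ∼F G.  The argument only concerns the "sides"
-- of G (its members and their complements):
--   * sides of a laminarizable family are pairwise non-crossing, hence for
--     two sides S, T sharing a point and having a common outside point,
--     one point of T ∖ S already forces S ⊆ T  (lemma nested);
--   * since F and G display the same strong quartets, every bipartite
--     quartet ab‖a'b' split by X is split the same way by some side of G.
-- From these two facts alone, a cut X must itself be a side (cut-is-side):
-- first, starting from any side splitting a quartet of X, we shrink it
-- strictly until it lies inside X (shrink-into); then we grow a side inside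
-- X strictly until it equals X (fill-step).  Both loops terminate by
-- well-founded descent on a cardinality measure (measure-descent).

open import Defs
open import Data.Nat using (ℕ; _≤_; _<_)
open import Data.Nat.Induction using (<-wellFounded)
open import Induction.WellFounded using (Acc; acc)
open import Data.Fin using (Fin)
open import Data.Fin.Subset using (Subset; ∁; ∣_∣; _∈_; _∉_; _⊆_; _∩_)
open import Data.Fin.Subset.Properties
  using (_∈?_; ⊆-antisym; p⊂q⇒∣p∣<∣q∣; p⊂q⇒∁p⊃∁q;
         x∈∁p⇒x∉p; x∉p⇒x∈∁p; x∉∁p⇒x∈p; x∈p⇒x∉∁p; x∈p∩q⁻; x∈p∩q⁺; ∉⊥)
open import Data.Fin.Properties using (any?)
open import Data.Product using (∃; _×_; _,_)
open import Data.Sum using (_⊎_; inj₁; inj₂)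
open import Data.Empty using (⊥-elim)
open import Relation.Nullary using (¬_; yes; no)
open import Relation.Nullary.Decidable using (_×-dec_; ¬?)
open import Relation.Binary.PropositionalEquality using (_≡_; _≢_; refl; sym; trans; cong; subst)
open import Function.Bundles using (Equivalence)

∁-involutive : ∀ {n} (X : Subset n) → ∁ (∁ X) ≡ X
∁-involutive X = ⊆-antisym (λ h → x∉∁p⇒x∈p (x∈∁p⇒x∉p h)) (λ h → x∉p⇒x∈∁p (x∈p⇒x∉∁p h))

∼-sym : ∀ {n} {X Y : Subset n} → X ∼ Y → Y ∼ X
∼-sym (inj₁ X≡Y) = inj₁ (sym X≡Y)
∼-sym {Y = Y} (inj₂ X≡∁Y) = inj₂ (trans (sym (∁-involutive Y)) (cong ∁ (sym X≡∁Y)))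

⊆-or-escape : ∀ {n} (S T : Subset n) → S ⊆ T ⊎ ∃ λ x → x ∈ S × x ∉ T
⊆-or-escape S T with any? (λ x → x ∈? S ×-dec ¬? (x ∈? T))
... | yes escape = inj₂ escape
... | no ¬escape = inj₁ S⊆T
  where
  S⊆T : S ⊆ T
  S⊆T {x} x∈S with x ∈? T
  ... | yes x∈T = x∈T
  ... | no x∉T = ⊥-elim (¬escape (x , x∈S , x∉T))

escape-from-proper : ∀ {n} (X Y : Subset n) → ¬ (X ∩ Y ≡ Y) → ∃ λ y → y ∈ Y × y ∉ X
escape-from-proper X Y X∩Y≢Y with ⊆-or-escape Y X
... | inj₂ escape = escape
... | inj₁ Y⊆X = ⊥-elim (X∩Y≢Y (⊆-antisym (λ h → let (_ , y∈Y) = x∈p∩q⁻ X Y h in y∈Y)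
                                            (λ y∈Y → x∈p∩q⁺ (Y⊆X y∈Y , y∈Y))))

measure-descent : ∀ {n} {P : Subset n → Set} {R : Set} (μ : Subset n → ℕ) →
  (∀ {T} → P T → R ⊎ ∃ λ U → P U × μ U < μ T) → ∀ {T} → P T → R
measure-descent {P = P} {R = R} μ advance {T} pT = descend (<-wellFounded (μ T)) pT
  where
  descend : ∀ {T} → Acc _<_ (μ T) → P T → R
  descend (acc smaller) pT with advance pT
  ... | inj₁ r = r
  ... | inj₂ (U , pU , μU<μT) = descend (smaller μU<μT) pU

Cross : ∀ {n} → Subset n → Subset n → Set
Cross S T = (∃ λ p → p ∈ S × p ∈ T) × (∃ λ q → q ∈ S × q ∉ T)
          × (∃ λ r → r ∉ S × r ∈ T) × (∃ λ s → s ∉ S × s ∉ T)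

cross-sym : ∀ {n} {S T : Subset n} → Cross S T → Cross T S
cross-sym ((p , p∈S , p∈T) , (q , q∈S , q∉T) , (r , r∉S , r∈T) , (s , s∉S , s∉T)) =
  (p , p∈T , p∈S) , (r , r∈T , r∉S) , (q , q∉T , q∈S) , (s , s∉T , s∉S)

-- Complementing S permutes the four regions, so crossing is unaffected.
cross-∁ˡ : ∀ {n} {S T : Subset n} → Cross (∁ S) T → Cross S T
cross-∁ˡ ((p , p∈∁S , p∈T) , (q , q∈∁S , q∉T) , (r , r∉∁S , r∈T) , (s , s∉∁S , s∉T)) =
  (r , x∉∁p⇒x∈p r∉∁S , r∈T) , (s , x∉∁p⇒x∈p s∉∁S , s∉T)
  , (p , x∈∁p⇒x∉p p∈∁S , p∈T) , (q , x∈∁p⇒x∉p q∈∁S , q∉T)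

cross-∼ˡ : ∀ {n} {S Y T : Subset n} → S ∼ Y → Cross S T → Cross Y T
cross-∼ˡ (inj₁ refl) = λ c → c
cross-∼ˡ (inj₂ refl) = cross-∁ˡ

cross-∼ʳ : ∀ {n} {S T Y : Subset n} → T ∼ Y → Cross S T → Cross S Y
cross-∼ʳ T∼Y c = cross-sym (cross-∼ˡ T∼Y (cross-sym c))

-- Members of a laminar family never cross: nested sets have an empty
-- difference, disjoint sets an empty intersection.
laminar⇒¬cross : ∀ {n} {L : Family n} → Laminar L → ∀ {Z Z'} → L Z → L Z' → ¬ Cross Z Z'
laminar⇒¬cross lam {Z} {Z'} LZ LZ' ((p , p∈Z , p∈Z') , (q , q∈Z , q∉Z') , (r , r∉Z , r∈Z') , _)
  with lam Z Z' LZ LZ'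
... | inj₁ Z⊆Z' = q∉Z' (Z⊆Z' q∈Z)
... | inj₂ (inj₁ Z'⊆Z) = r∉Z (Z'⊆Z r∈Z')
... | inj₂ (inj₂ Z∩Z'≡⊥) = ∉⊥ (subst (p ∈_) Z∩Z'≡⊥ (x∈p∩q⁺ (p∈Z , p∈Z')))

CrossFree : ∀ {n} → (Subset n → Set) → Set
CrossFree Side = ∀ {S T} → Side S → Side T → ¬ Cross S T

SidesOf : ∀ {n} → Family n → Subset n → Set
SidesOf G S = ∃ λ Y → G Y × S ∼ Y

-- The sides of a laminarizable family are cross-free, since each side is
-- ∼-equivalent to a member of the laminar family.
laminarizable⇒crossFree : ∀ {n} {A : Subset n} {G : Family n} →
  Laminarizable A G → CrossFree (SidesOf G)
laminarizable⇒crossFree (L , _ , lam , G→L , _) (Y , GY , S∼Y) (Y' , GY' , T∼Y') cross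
  with G→L Y GY | G→L Y' GY'
... | Z , LZ , Y∼Z | Z' , LZ' , Y'∼Z' =
  laminar⇒¬cross lam LZ LZ'
    (cross-∼ʳ Y'∼Z' (cross-∼ʳ T∼Y' (cross-∼ˡ Y∼Z (cross-∼ˡ S∼Y cross))))

nested : ∀ {n} {Side : Subset n → Set} → CrossFree Side → ∀ {S T} → Side S → Side T →
  ∀ {p r s} → p ∈ S → p ∈ T → r ∉ S → r ∈ T → s ∉ S → s ∉ T → S ⊆ T
nested cf {T = T} sS sT {p} {r} {s} p∈S p∈T r∉S r∈T s∉S s∉T {q} q∈S with q ∈? T
... | yes q∈T = q∈T
... | no q∉T = ⊥-elim (cf sS sT ((p , p∈S , p∈T) , (q , q∈S , q∉T) , (r , r∉S , r∈T) , (s , s∉S , s∉T)))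

SplitsRealized : ∀ {n} → Subset n → Subset n → (Subset n → Set) → Set
SplitsRealized A X Side = ∀ {a b a' b'} → a ∈ A → b ∉ A → a' ∈ A → b' ∉ A →
  a ∈ X → b ∈ X → a' ∉ X → b' ∉ X → ∃ λ S → Side S × a ∈ S × b ∈ S × a' ∉ S × b' ∉ S

module CutIsSide {n : ℕ} (A X : Subset n) {Side : Subset n → Set}
  (cf : CrossFree Side) (realized : SplitsRealized A X Side)
  {a2 b2 : Fin n} (a2∈A : a2 ∈ A) (a2∉X : a2 ∉ X) (b2∉A : b2 ∉ A) (b2∉X : b2 ∉ X) where

  Through : Fin n → Fin n → Subset n → Set
  Through a b T = Side T × a ∈ T × b ∈ T × a2 ∉ T × b2 ∉ T

  Inside : Fin n → Fin n → Set
  Inside a b = ∃ λ T → Side T × T ⊆ X × a ∈ T × b ∈ T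

  -- A side through a, b containing some y ∉ X can be strictly shrunk: the
  -- side realizing ab‖yb2 (or ab‖a2y) is nested in it and misses y.
  shrink-step : ∀ {a b} → a ∈ A → b ∉ A → a ∈ X → b ∈ X →
    ∀ {T} → Through a b T → Inside a b ⊎ ∃ λ U → Through a b U × ∣ U ∣ < ∣ T ∣
  shrink-step {a} {b} a∈A b∉A a∈X b∈X {T} (sT , a∈T , b∈T , a2∉T , b2∉T) with ⊆-or-escape T X
  ... | inj₁ T⊆X = inj₁ (T , sT , T⊆X , a∈T , b∈T)
  ... | inj₂ (y , y∈T , y∉X) with y ∈? A
  ... | yes y∈A with realized a∈A b∉A y∈A b2∉A a∈X b∈X y∉X b2∉X
  ... | U , sU , a∈U , b∈U , y∉U , b2∉U =
    inj₂ (U , (sU , a∈U , b∈U , (λ a2∈U → a2∉T (U⊆T a2∈U)) , b2∉U) , p⊂q⇒∣p∣<∣q∣ (U⊆T , y , y∈T , y∉U))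
    where
    U⊆T : U ⊆ T
    U⊆T = nested cf sU sT a∈U a∈T y∉U y∈T b2∉U b2∉T
  shrink-step {a} {b} a∈A b∉A a∈X b∈X {T} (sT , a∈T , b∈T , a2∉T , b2∉T)
    | inj₂ (y , y∈T , y∉X) | no y∉A with realized a∈A b∉A a2∈A y∉A a∈X b∈X a2∉X y∉X
  ... | U , sU , a∈U , b∈U , a2∉U , y∉U =
    inj₂ (U , (sU , a∈U , b∈U , a2∉U , (λ b2∈U → b2∉T (U⊆T b2∈U))) , p⊂q⇒∣p∣<∣q∣ (U⊆T , y , y∈T , y∉U))
    where
    U⊆T : U ⊆ T
    U⊆T = nested cf sU sT a∈U a∈T y∉U y∈T a2∉U a2∉T

  shrink-into : ∀ {a b} → a ∈ A → b ∉ A → a ∈ X → b ∈ X → Inside a b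
  shrink-into a∈A b∉A a∈X b∈X with realized a∈A b∉A a2∈A b2∉A a∈X b∈X a2∉X b2∉X
  ... | T , sT , a∈T , b∈T , a2∉T , b2∉T =
    measure-descent ∣_∣ (shrink-step a∈A b∉A a∈X b∈X) (sT , a∈T , b∈T , a2∉T , b2∉T)

  grows : ∀ (S T : Subset n) {x} → S ⊆ T → x ∈ T → x ∉ S → ∣ ∁ T ∣ < ∣ ∁ S ∣
  grows S T {x} S⊆T x∈T x∉S = p⊂q⇒∣p∣<∣q∣ (p⊂q⇒∁p⊃∁q (S⊆T , x , x∈T , x∉S))

  -- A side S ⊆ X through a0, b0 missing some x ∈ X can be strictly grown:
  -- the side inside X through x and the point of S on the other side of
  -- {A,B} contains S, since a2 lies outside both.
  fill-step : ∀ {a0 b0} → a0 ∈ A → b0 ∉ A → ∀ {S} → Side S × S ⊆ X × a0 ∈ S × b0 ∈ S →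
    (∃ λ S → Side S × S ≡ X) ⊎ ∃ λ T → (Side T × T ⊆ X × a0 ∈ T × b0 ∈ T) × ∣ ∁ T ∣ < ∣ ∁ S ∣
  fill-step {a0} {b0} a0∈A b0∉A {S} (sS , S⊆X , a0∈S , b0∈S) with ⊆-or-escape X S
  ... | inj₁ X⊆S = inj₁ (S , sS , ⊆-antisym S⊆X X⊆S)
  ... | inj₂ (x , x∈X , x∉S) with x ∈? A
  ... | yes x∈A with shrink-into x∈A b0∉A x∈X (S⊆X b0∈S)
  ... | T , sT , T⊆X , x∈T , b0∈T = inj₂ (T , (sT , T⊆X , S⊆T a0∈S , b0∈T) , grows S T S⊆T x∈T x∉S)
    where
    S⊆T : S ⊆ T
    S⊆T = nested cf sS sT b0∈S b0∈T x∉S x∈T (λ h → a2∉X (S⊆X h)) (λ h → a2∉X (T⊆X h))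
  fill-step {a0} {b0} a0∈A b0∉A {S} (sS , S⊆X , a0∈S , b0∈S)
    | inj₂ (x , x∈X , x∉S) | no x∉A with shrink-into a0∈A x∉A (S⊆X a0∈S) x∈X
  ... | T , sT , T⊆X , a0∈T , x∈T = inj₂ (T , (sT , T⊆X , a0∈T , S⊆T b0∈S) , grows S T S⊆T x∈T x∉S)
    where
    S⊆T : S ⊆ T
    S⊆T = nested cf sS sT a0∈S a0∈T x∉S x∈T (λ h → a2∉X (S⊆X h)) (λ h → a2∉X (T⊆X h))

  cut-is-side : ∀ {a0 b0} → a0 ∈ A → b0 ∉ A → a0 ∈ X → b0 ∈ X → ∃ λ S → Side S × S ≡ X
  cut-is-side a0∈A b0∉A a0∈X b0∈X with shrink-into a0∈A b0∉A a0∈X b0∈X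
  ... | S , sS , S⊆X , a0∈S , b0∈S =
    measure-descent (λ S → ∣ ∁ S ∣) (fill-step a0∈A b0∉A) (sS , S⊆X , a0∈S , b0∈S)

SplitBy : ∀ {n} → Family n → Fin n → Fin n → Fin n → Fin n → Set
SplitBy H a b a' b' = ∃ λ X → H X ×
  ((a ∈ X × b ∈ X × a' ∉ X × b' ∉ X) ⊎ (a ∉ X × b ∉ X × a' ∈ X × b' ∈ X))

same-splits : ∀ {n} {A : Subset n} {Q : QuartetSystem n} {F G : Family n} →
  FamilyDisplays A F Q → FamilyDisplays A G Q →
  ∀ {a b a' b'} → a ∈ A → b ∉ A → a' ∈ A → b' ∉ A → a ≢ a' → b ≢ b' →
  SplitBy F a b a' b' → SplitBy G a b a' b'
same-splits dF dG {a} {b} {a'} {b'} a∈A b∉A a'∈A b'∉A a≢a' b≢b' split =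
  Equivalence.to (dG a a' b b' a∈A a'∈A a≢a' (x∉p⇒x∈∁p b∉A) (x∉p⇒x∈∁p b'∉A) b≢b')
    (Equivalence.from (dF a a' b b' a∈A a'∈A a≢a' (x∉p⇒x∈∁p b∉A) (x∉p⇒x∈∁p b'∉A) b≢b') split)

-- Hence every split of a member of F is realized by a side of G (taking the
-- complement when the G-member splits the quartet the other way round).
displayed-splits-realized : ∀ {n} {A : Subset n} {Q : QuartetSystem n} {F G : Family n} →
  FamilyDisplays A F Q → FamilyDisplays A G Q → ∀ {X} → F X → SplitsRealized A X (SidesOf G)
displayed-splits-realized dF dG {X} FX a∈A b∉A a'∈A b'∉A a∈X b∈X a'∉X b'∉X
  with same-splits dF dG a∈A b∉A a'∈A b'∉A (λ { refl → a'∉X a∈X }) (λ { refl → b'∉X b∈X })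
         (X , FX , inj₁ (a∈X , b∈X , a'∉X , b'∉X))
... | Y , GY , inj₁ (a∈Y , b∈Y , a'∉Y , b'∉Y) = Y , (Y , GY , inj₁ refl) , a∈Y , b∈Y , a'∉Y , b'∉Y
... | Y , GY , inj₂ (a∉Y , b∉Y , a'∈Y , b'∈Y) =
  ∁ Y , (Y , GY , inj₂ refl) , x∉p⇒x∈∁p a∉Y , x∉p⇒x∈∁p b∉Y , x∈p⇒x∉∁p a'∈Y , x∈p⇒x∉∁p b'∈Y

displayed-cut-in : ∀ {n} (A : Subset n) {Q : QuartetSystem n} (F G : Family n) →
  CutFamily A F → FamilyDisplays A F Q → Laminarizable A G → FamilyDisplays A G Q →
  ∀ X → F X → ∃ λ Y → G Y × X ∼ Y
displayed-cut-in A F G cF dF lG dG X FX with cF X FX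
... | (a0 , a0∈X∩A) , X∩A≢A , (b0 , b0∈X∩B) , X∩B≢B
  with escape-from-proper X A X∩A≢A | escape-from-proper X (∁ A) X∩B≢B
... | a2 , a2∈A , a2∉X | b2 , b2∈B , b2∉X
  with x∈p∩q⁻ X A a0∈X∩A | x∈p∩q⁻ X (∁ A) b0∈X∩B
... | a0∈X , a0∈A | b0∈X , b0∈B
  with CutIsSide.cut-is-side A X (laminarizable⇒crossFree lG) (displayed-splits-realized dF dG FX)
         a2∈A a2∉X (x∈∁p⇒x∉p b2∈B) b2∉X a0∈A (x∈∁p⇒x∉p b0∈B) a0∈X b0∈X
... | S , (Y , GY , S∼Y) , refl = Y , GY , S∼Y

-- Apply displayed-cut-in in both directions.
proposition2p3 : (n : ℕ) (A : Subset n) → 2 ≤ ∣ A ∣ → 2 ≤ ∣ ∁ A ∣ →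
    (Q : QuartetSystem n) → Compatible Q → CompleteBipartite A Q →
    (F G : Family n) →
    CutFamily A F → Laminarizable A F → FamilyDisplays A F Q →
    CutFamily A G → Laminarizable A G → FamilyDisplays A G Q →
    F ∼F G
proposition2p3 n A _ _ Q _ _ F G cF lF dF cG lG dG =
  displayed-cut-in A F G cF dF lG dG ,
  λ Y GY → let (X , FX , Y∼X) = displayed-cut-in A G F cG dG lF dF Y GY in X , FX , ∼-sym Y∼X
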